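{- The following are derived rules of $\mathbf{FBI}$ (i.e., whenever the premises are provable in $\mathbf{FBI}$ and the side conditions hold, the conclusion is provable in $\mathbf{FBI}$): (B-Ind): with no premises, conclude $(\neg\varphi,\tau,\beta)$, provided $\beta\Rightarrow\varphi$ and $\varphi'\wedge\tau\Rightarrow\varphi$; (B-Cons): from the premise $(\neg\varphi,\tau,\beta)$ conclude $(\iota,\tau,\beta)$, provided $\varphi\Rightarrow\neg\iota$; (B-Inc): from the premises $(\neg\varphi,\tau,\beta)$ and $(\iota\wedge\varphi,\ \tau\wedge\varphi\wedge\varphi',\ \beta\wedge\varphi)$ conclude $(\iota,\tau,\beta)$.
   Context: Let $\Sigma$ be a first-order vocabulary and $\Sigma'$ its primed copy; $\varphi'$ denotes $\varphi$ with every symbol primed. A safety problem is a triple $(\iota,\tau,\beta)$ of closed formulas, $\iota,\beta$ over $\Sigma$ and $\tau$ over $\Sigma\cup\Sigma'$; $\varphi$ ranges over closed formulas over $\Sigma$. $\tau^{ -1}$ is obtained from $\tau$ by replacing each symbol of $\Sigma$ by its primed counterpart and vice versa. $A\Rightarrow B$ denotes validity of $A\to B$. The proof system $\mathbf{FBI}$ has rules: (Ind): with no premises, conclude $(\iota,\tau,\neg\varphi)$ provided $\iota\Rightarrow\varphi$ and $\varphi\wedge\tau\Rightarrow\varphi'$; (Cons): from $(\iota,\tau,\neg\varphi)$ conclude $(\iota,\tau,\beta)$ provided $\varphi\Rightarrow\neg\beta$; (Inc): from premises $(\iota,\tau,\neg\varphi)$ and $(\iota\wedge\varphi,\tau\wedge\varphi\wedge\varphi',\beta\wedge\varphi)$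 conclude $(\iota,\tau,\beta)$; (Rev): from $(\beta,\tau^{ -1},\iota)$ conclude $(\iota,\tau,\beta)$. A proof is a finite tree of safety problems, each node the conclusion of a rule applied to its children. -}

module Defs where

open import Data.Nat using (ℕ; zero; suc)
open import Data.Fin using (Fin)
open import Data.Vec using (Vec; []; _∷_; lookup)
open import Data.Bool using (Bool; true; false; not; T)
open import Data.Unit using (⊤)
open import Data.Empty using (⊥)
open import Data.Product using (_×_)
open import Relation.Nullary using (¬_)
open import Relation.Binary.PropositionalEquality using (_≡_)

record Vocabulary : Set₁ where
  field
    Fun    : Set
    fArity : Fun → ℕ
    Rel    : Set
    rArity : Rel → ℕ

open Vocabulary public

-- Symbols of the vocabulary are used with a "tag" from a type K:
--   K = ⊤    : formulas over Σ
--   K = Bool : formulas over Σ ∪ Σ'  (false = unprimed, true = primed)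
-- Variables are de Bruijn indices; closed formulas are  Formula V K 0.

data Term (V : Vocabulary) (K : Set) (n : ℕ) : Set where
  var : Fin n → Term V K n
  app : K → (f : Fun V) → Vec (Term V K n) (fArity V f) → Term V K n

infix  7 _≐_
infixr 6 _∧'_
infixr 5 _∨'_
infixr 4 _⇒'_

data Formula (V : Vocabulary) (K : Set) : ℕ → Set where
  rel  : ∀ {n} → K → (r : Rel V) → Vec (Term V K n) (rArity V r) → Formula V K n
  _≐_  : ∀ {n} → Term V K n → Term V K n → Formula V K n
  ⊤'   : ∀ {n} → Formula V K n
  ⊥'   : ∀ {n} → Formula V K n
  ¬'_  : ∀ {n} → Formula V K n → Formula V K n
  _∧'_ : ∀ {n} → Formula V K n → Formula V K n → Formula V K n
  _∨'_ : ∀ {n} → Formula V K n → Formula V K n → Formula V K n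
  _⇒'_ : ∀ {n} → Formula V K n → Formula V K n → Formula V K n
  ∀'   : ∀ {n} → Formula V K (suc n) → Formula V K n
  ∃'   : ∀ {n} → Formula V K (suc n) → Formula V K n

module _ {V : Vocabulary} {K L : Set} (g : K → L) where
  renTerm  : ∀ {n} → Term V K n → Term V L n
  renTerms : ∀ {n m} → Vec (Term V K n) m → Vec (Term V L n) m
  renTerm (var i)      = var i
  renTerm (app k f ts) = app (g k) f (renTerms ts)
  renTerms []       = []
  renTerms (t ∷ ts) = renTerm t ∷ renTerms ts

  ren : ∀ {n} → Formula V K n → Formula V L n
  ren (rel k r ts) = rel (g k) r (renTerms ts)
  ren (s ≐ t)      = renTerm s ≐ renTerm t
  ren ⊤'           = ⊤'
  ren ⊥'           = ⊥'
  ren (¬' A)       = ¬' ren A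
  ren (A ∧' B)     = ren A ∧' ren B
  ren (A ∨' B)     = ren A ∨' ren B
  ren (A ⇒' B)     = ren A ⇒' ren B
  ren (∀' A)       = ∀' (ren A)
  ren (∃' A)       = ∃' (ren A)

emb : ∀ {V n} → Formula V ⊤ n → Formula V Bool n
emb = ren (λ _ → false)

prime : ∀ {V n} → Formula V ⊤ n → Formula V Bool n
prime = ren (λ _ → true)

inv : ∀ {V n} → Formula V Bool n → Formula V Bool n
inv = ren not

-- Semantics (classical first-order semantics, rendered constructively by
-- the double-negation reading: atoms are Bool-valued, equality is ¬¬≡,
-- ∨ and ∃ are read via ¬/×/∀; every interpretation is ¬¬-stable).
-- Domains are non-empty.

record Structure (V : Vocabulary) (K : Set) : Set₁ where
  field
    D     : Set
    elem  : D
    funI  : K → (f : Fun V) → Vec D (fArity V f) → D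
    relI  : K → (r : Rel V) → Vec D (rArity V r) → Bool

module _ {V : Vocabulary} {K : Set} (M : Structure V K) where
  open Structure M

  evalT  : ∀ {n} → Vec D n → Term V K n → D
  evalTs : ∀ {n m} → Vec D n → Vec (Term V K n) m → Vec D m
  evalT ρ (var i)      = lookup ρ i
  evalT ρ (app k f ts) = funI k f (evalTs ρ ts)
  evalTs ρ []       = []
  evalTs ρ (t ∷ ts) = evalT ρ t ∷ evalTs ρ ts

  ⟦_⟧ : ∀ {n} → Formula V K n → Vec D n → Set
  ⟦ rel k r ts ⟧ ρ = T (relI k r (evalTs ρ ts))
  ⟦ s ≐ t ⟧      ρ = ¬ ¬ (evalT ρ s ≡ evalT ρ t)
  ⟦ ⊤' ⟧         ρ = ⊤
  ⟦ ⊥' ⟧         ρ = ⊥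
  ⟦ ¬' A ⟧       ρ = ¬ ⟦ A ⟧ ρ
  ⟦ A ∧' B ⟧     ρ = ⟦ A ⟧ ρ × ⟦ B ⟧ ρ
  ⟦ A ∨' B ⟧     ρ = ¬ ((¬ ⟦ A ⟧ ρ) × (¬ ⟦ B ⟧ ρ))
  ⟦ A ⇒' B ⟧     ρ = ⟦ A ⟧ ρ → ⟦ B ⟧ ρ
  ⟦ ∀' A ⟧       ρ = (x : D) → ⟦ A ⟧ (x ∷ ρ)
  ⟦ ∃' A ⟧       ρ = ¬ ((x : D) → ¬ ⟦ A ⟧ (x ∷ ρ))

Valid : ∀ {V K} → Formula V K 0 → Set₁
Valid {V} {K} A = (M : Structure V K) → ⟦ M ⟧ A []

infix 2 _⇛_
_⇛_ : ∀ {V K} → Formula V K 0 → Formula V K 0 → Set₁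
A ⇛ B = Valid (A ⇒' B)

record SafetyProblem (V : Vocabulary) : Set where
  constructor ⟨_,_,_⟩
  field
    ι : Formula V ⊤ 0
    τ : Formula V Bool 0
    β : Formula V ⊤ 0

data FBI (V : Vocabulary) : SafetyProblem V → Set₁ where
  Ind  : ∀ {ι τ φ} →
         ι ⇛ φ → (emb φ ∧' τ) ⇛ prime φ →
         FBI V ⟨ ι , τ , ¬' φ ⟩
  Cons : ∀ {ι τ φ β} →
         φ ⇛ ¬' β →
         FBI V ⟨ ι , τ , ¬' φ ⟩ →
         FBI V ⟨ ι , τ , β ⟩
  Inc  : ∀ {ι τ φ β} →
         FBI V ⟨ ι , τ , ¬' φ ⟩ →
         FBI V ⟨ ι ∧' φ , τ ∧' emb φ ∧' prime φ , β ∧' φ ⟩ →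
         FBI V ⟨ ι , τ , β ⟩
  Rev  : ∀ {ι τ β} →
         FBI V ⟨ β , inv τ , ι ⟩ →
         FBI V ⟨ ι , τ , β ⟩

{-# OPTIONS --safe #-}
module Submission where

-- Each backward rule is the forward rule of the same name conjugated by (Rev).
-- (Rev) can be undone because τ ↦ τ⁻¹ is a syntactic involution, and the
-- inverted side conditions of (Ind) and (Cons) are exactly those of (B-Ind) and
-- (B-Cons), since validity is preserved by any renaming of symbol tags: a
-- structure for the renamed vocabulary restricts along the renaming to one for
-- the original.

open import Defs
open import Data.Bool using (Bool; not)
open import Data.Bool.Properties using (not-involutive)
open import Data.Product using (_×_; _,_)
open import Data.Product.Function.NonDependent.Propositional using (_×-⇔_)
open import Data.Unit using (⊤)
open import Data.Vec using (Vec; []; _∷_)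
open import Function using (_∘_; id; _⇔_; mk⇔; Equivalence)
open import Function.Construct.Identity using (⇔-id)
open import Function.Related.TypeIsomorphisms using (¬-cong-⇔; →-cong-⇔)
open import Level using (Level)
open import Relation.Binary.PropositionalEquality
  using (_≡_; refl; sym; trans; cong; cong₂; subst; subst₂)

open Structure using (D; elem; funI; relI)
open Equivalence using (to; from)

private
  variable
    a b : Level
    V : Vocabulary
    K L J : Set

Π-cong-⇔ : {A : Set a} {P Q : A → Set b} →
           (∀ x → P x ⇔ Q x) → ((x : A) → P x) ⇔ ((x : A) → Q x)
Π-cong-⇔ P⇔Q = mk⇔ (λ p x → to (P⇔Q x) (p x)) (λ q x → from (P⇔Q x) (q x))

module _ {h : K → L} {g : L → J} {f : K → J} (fusion : ∀ k → g (h k) ≡ f k) where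
  renTerm-fusion : ∀ {n} (t : Term V K n) → renTerm g (renTerm h t) ≡ renTerm f t
  renTerms-fusion : ∀ {n m} (ts : Vec (Term V K n) m) →
                    renTerms g (renTerms h ts) ≡ renTerms f ts
  renTerm-fusion (var i)      = refl
  renTerm-fusion (app k s ts) = cong₂ (λ k′ → app k′ s) (fusion k) (renTerms-fusion ts)
  renTerms-fusion []       = refl
  renTerms-fusion (t ∷ ts) = cong₂ _∷_ (renTerm-fusion t) (renTerms-fusion ts)

  ren-fusion : ∀ {n} (A : Formula V K n) → ren g (ren h A) ≡ ren f A
  ren-fusion (rel k r ts) = cong₂ (λ k′ → rel k′ r) (fusion k) (renTerms-fusion ts)
  ren-fusion (s ≐ t)      = cong₂ _≐_ (renTerm-fusion s) (renTerm-fusion t)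
  ren-fusion ⊤'           = refl
  ren-fusion ⊥'           = refl
  ren-fusion (¬' A)       = cong ¬'_ (ren-fusion A)
  ren-fusion (A ∧' B)     = cong₂ _∧'_ (ren-fusion A) (ren-fusion B)
  ren-fusion (A ∨' B)     = cong₂ _∨'_ (ren-fusion A) (ren-fusion B)
  ren-fusion (A ⇒' B)     = cong₂ _⇒'_ (ren-fusion A) (ren-fusion B)
  ren-fusion (∀' A)       = cong ∀' (ren-fusion A)
  ren-fusion (∃' A)       = cong ∃' (ren-fusion A)

renTerm-id : ∀ {n} (t : Term V K n) → renTerm id t ≡ t
renTerms-id : ∀ {n m} (ts : Vec (Term V K n) m) → renTerms id ts ≡ ts
renTerm-id (var i)      = refl
renTerm-id (app k f ts) = cong (app k f) (renTerms-id ts)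
renTerms-id []       = refl
renTerms-id (t ∷ ts) = cong₂ _∷_ (renTerm-id t) (renTerms-id ts)

ren-id : ∀ {n} (A : Formula V K n) → ren id A ≡ A
ren-id (rel k r ts) = cong (rel k r) (renTerms-id ts)
ren-id (s ≐ t)      = cong₂ _≐_ (renTerm-id s) (renTerm-id t)
ren-id ⊤'           = refl
ren-id ⊥'           = refl
ren-id (¬' A)       = cong ¬'_ (ren-id A)
ren-id (A ∧' B)     = cong₂ _∧'_ (ren-id A) (ren-id B)
ren-id (A ∨' B)     = cong₂ _∨'_ (ren-id A) (ren-id B)
ren-id (A ⇒' B)     = cong₂ _⇒'_ (ren-id A) (ren-id B)
ren-id (∀' A)       = cong ∀' (ren-id A)
ren-id (∃' A)       = cong ∃' (ren-id A)

inv-involutive : ∀ {n} (A : Formula V Bool n) → inv (inv A) ≡ A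
inv-involutive A = trans (ren-fusion not-involutive A) (ren-id A)

inv-emb : ∀ {n} (φ : Formula V ⊤ n) → inv (emb φ) ≡ prime φ
inv-emb = ren-fusion (λ _ → refl)

inv-prime : ∀ {n} (φ : Formula V ⊤ n) → inv (prime φ) ≡ emb φ
inv-prime = ren-fusion (λ _ → refl)

reduct : Structure V L → (K → L) → Structure V K
reduct M g = record { D = D M ; elem = elem M ; funI = funI M ∘ g ; relI = relI M ∘ g }

module _ (M : Structure V L) (g : K → L) where
  evalT-renTerm : ∀ {n} (ρ : Vec (D M) n) (t : Term V K n) →
                  evalT M ρ (renTerm g t) ≡ evalT (reduct M g) ρ t
  evalTs-renTerms : ∀ {n m} (ρ : Vec (D M) n) (ts : Vec (Term V K n) m) →
                    evalTs M ρ (renTerms g ts) ≡ evalTs (reduct M g) ρ ts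
  evalT-renTerm ρ (var i)      = refl
  evalT-renTerm ρ (app k f ts) = cong (funI M (g k) f) (evalTs-renTerms ρ ts)
  evalTs-renTerms ρ []       = refl
  evalTs-renTerms ρ (t ∷ ts) = cong₂ _∷_ (evalT-renTerm ρ t) (evalTs-renTerms ρ ts)

  ⟦ren⟧⇔⟦reduct⟧ : ∀ {n} (A : Formula V K n) (ρ : Vec (D M) n) →
                   ⟦ M ⟧ (ren g A) ρ ⇔ ⟦ reduct M g ⟧ A ρ
  ⟦ren⟧⇔⟦reduct⟧ (rel k r ts) ρ rewrite evalTs-renTerms ρ ts = ⇔-id _
  ⟦ren⟧⇔⟦reduct⟧ (s ≐ t) ρ rewrite evalT-renTerm ρ s | evalT-renTerm ρ t = ⇔-id _
  ⟦ren⟧⇔⟦reduct⟧ ⊤' ρ       = ⇔-id _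
  ⟦ren⟧⇔⟦reduct⟧ ⊥' ρ       = ⇔-id _
  ⟦ren⟧⇔⟦reduct⟧ (¬' A) ρ   = ¬-cong-⇔ (⟦ren⟧⇔⟦reduct⟧ A ρ)
  ⟦ren⟧⇔⟦reduct⟧ (A ∧' B) ρ = ⟦ren⟧⇔⟦reduct⟧ A ρ ×-⇔ ⟦ren⟧⇔⟦reduct⟧ B ρ
  ⟦ren⟧⇔⟦reduct⟧ (A ∨' B) ρ =
    ¬-cong-⇔ (¬-cong-⇔ (⟦ren⟧⇔⟦reduct⟧ A ρ) ×-⇔ ¬-cong-⇔ (⟦ren⟧⇔⟦reduct⟧ B ρ))
  ⟦ren⟧⇔⟦reduct⟧ (A ⇒' B) ρ = →-cong-⇔ (⟦ren⟧⇔⟦reduct⟧ A ρ) (⟦ren⟧⇔⟦reduct⟧ B ρ)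
  ⟦ren⟧⇔⟦reduct⟧ (∀' A) ρ   = Π-cong-⇔ (λ x → ⟦ren⟧⇔⟦reduct⟧ A (x ∷ ρ))
  ⟦ren⟧⇔⟦reduct⟧ (∃' A) ρ   =
    ¬-cong-⇔ (Π-cong-⇔ (λ x → ¬-cong-⇔ (⟦ren⟧⇔⟦reduct⟧ A (x ∷ ρ))))

valid-ren : (g : K → L) {A : Formula V K 0} → Valid A → Valid (ren g A)
valid-ren g {A} ⊨A M = from (⟦ren⟧⇔⟦reduct⟧ M g A []) (⊨A (reduct M g))

⇛-inv : {A B : Formula V Bool 0} → A ⇛ B → inv A ⇛ inv B
⇛-inv {A = A} {B} = valid-ren not {A = A ⇒' B}

FBI-antimono-τ : ∀ {ι τ τ₂ β} → τ₂ ⇛ τ → FBI V ⟨ ι , τ , β ⟩ → FBI V ⟨ ι , τ₂ , β ⟩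
FBI-antimono-τ τ₂⇛τ (Ind ι⇛φ step) = Ind ι⇛φ (λ M (φ , t₂) → step M (φ , τ₂⇛τ M t₂))
FBI-antimono-τ τ₂⇛τ (Cons φ⇛¬β p)  = Cons φ⇛¬β (FBI-antimono-τ τ₂⇛τ p)
FBI-antimono-τ τ₂⇛τ (Inc p q)      =
  Inc (FBI-antimono-τ τ₂⇛τ p) (FBI-antimono-τ (λ M (t₂ , φφ′) → τ₂⇛τ M t₂ , φφ′) q)
FBI-antimono-τ {τ = τ} {τ₂} τ₂⇛τ (Rev p) =
  Rev (FBI-antimono-τ (⇛-inv {A = τ₂} {τ} τ₂⇛τ) p)

Rev⁻¹ : ∀ {ι τ β} → FBI V ⟨ ι , τ , β ⟩ → FBI V ⟨ β , inv τ , ι ⟩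
Rev⁻¹ {V} {ι} {τ} {β} p =
  Rev (subst (λ τ′ → FBI V ⟨ ι , τ′ , β ⟩) (sym (inv-involutive τ)) p)

B-Ind : ∀ {τ φ β} → β ⇛ φ → (prime φ ∧' τ) ⇛ emb φ → FBI V ⟨ ¬' φ , τ , β ⟩
B-Ind {τ = τ} {φ} β⇛φ backstep = Rev (Ind β⇛φ step)
  where
  step : (emb φ ∧' inv τ) ⇛ prime φ
  step = subst₂ _⇛_ (cong (_∧' inv τ) (inv-prime φ)) (inv-emb φ)
                (⇛-inv {A = prime φ ∧' τ} {emb φ} backstep)

B-Cons : ∀ {ι τ φ β} → φ ⇛ ¬' ι → FBI V ⟨ ¬' φ , τ , β ⟩ → FBI V ⟨ ι , τ , β ⟩
B-Cons φ⇛¬ι p = Rev (Cons φ⇛¬ι (Rev⁻¹ p))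

B-Inc : ∀ {ι τ φ β} →
        FBI V ⟨ ¬' φ , τ , β ⟩ →
        FBI V ⟨ ι ∧' φ , τ ∧' emb φ ∧' prime φ , β ∧' φ ⟩ →
        FBI V ⟨ ι , τ , β ⟩
B-Inc {V} {ι} {τ} {φ} {β} p q = Rev (Inc (Rev⁻¹ p) q⁻¹)
  where
  -- Reversing q directly would give the conjuncts in the order φ' ∧ φ, so swap them first.
  q-swapped : FBI V ⟨ ι ∧' φ , τ ∧' prime φ ∧' emb φ , β ∧' φ ⟩
  q-swapped = FBI-antimono-τ (λ M (t , φ′ , φ₀) → t , φ₀ , φ′) q

  q⁻¹ : FBI V ⟨ β ∧' φ , inv τ ∧' emb φ ∧' prime φ , ι ∧' φ ⟩
  q⁻¹ = subst (λ τ′ → FBI V ⟨ β ∧' φ , τ′ , ι ∧' φ ⟩)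
              (cong₂ (λ x y → inv τ ∧' x ∧' y) (inv-prime φ) (inv-emb φ))
              (Rev⁻¹ q-swapped)

theorem4p11 : (V : Vocabulary) →
    -- (B-Ind)
    ((τ : Formula V Bool 0) (φ β : Formula V ⊤ 0) →
      β ⇛ φ → (prime φ ∧' τ) ⇛ emb φ →
      FBI V ⟨ ¬' φ , τ , β ⟩)
    ×
    -- (B-Cons)
    ((ι : Formula V ⊤ 0) (τ : Formula V Bool 0) (φ β : Formula V ⊤ 0) →
      φ ⇛ ¬' ι →
      FBI V ⟨ ¬' φ , τ , β ⟩ →
      FBI V ⟨ ι , τ , β ⟩)
    ×
    -- (B-Inc)
    ((ι : Formula V ⊤ 0) (τ : Formula V Bool 0) (φ β : Formula V ⊤ 0) →
      FBI V ⟨ ¬' φ , τ , β ⟩ →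
      FBI V ⟨ ι ∧' φ , τ ∧' emb φ ∧' prime φ , β ∧' φ ⟩ →
      FBI V ⟨ ι , τ , β ⟩)
theorem4p11 V = (λ _ _ _ → B-Ind) , (λ _ _ _ _ → B-Cons) , (λ _ _ _ _ → B-Inc)
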